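{- Let $p\equiv1\pmod4$ be prime, let $K=kp$ be odd ($k$ a positive integer), and let $h$ be an integer with $(h,K)=1$. Then \[\tau_{\mathbf{os}}(h,K)\equiv\frac{p-1}{4}+\tau_{\mathbf{es}}(h,K)\pmod2\quad\text{and}\quad\tau_{\mathbf{or}}(h,K)\equiv\frac{p-1}{4}+\tau_{\mathbf{er}}(h,K)\pmod2.\]
   Context: $\chi_\mu=\left(\frac{\mu}{p}\right)$ is the Legendre symbol. For an integer $x$, $\{x\}_K$ is the unique integer with $x\equiv\{x\}_K\pmod K$ and $0\le\{x\}_K<K$. Define $\tau_{\mathbf{er}}(h,K)=\#\{0<\mu<K:\ p\nmid\mu,\ \mu\text{ even},\ \chi_\mu=1,\ \{h\mu\}_K\text{ odd}\}$, $\tau_{\mathbf{es}}(h,K)=\#\{0<\mu<K:\ p\nmid\mu,\ \mu\text{ even},\ \chi_\mu=-1,\ \{h\mu\}_K\text{ odd}\}$, $\tau_{\mathbf{or}}(h,K)=\#\{0<\mu<K:\ p\nmid\mu,\ \mu\text{ odd},\ \chi_\mu=1,\ \{h\mu\}_K\text{ odd}\}$, $\tau_{\mathbf{os}}(h,K)=\#\{0<\mu<K:\ p\nmid\mu,\ \mu\text{ odd},\ \chi_\mu=-1,\ \{h\mu\}_K\text{ odd}\}$. -}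

module Defs where

open import Data.Bool using (Bool; true; false; not; _∧_)
open import Data.Nat using (ℕ; zero; suc; _*_; _≡ᵇ_)
open import Data.Nat.DivMod using (_%_)
open import Data.Integer using (ℤ; +_)
import Data.Integer as ℤ
open import Data.Integer.DivMod using (_%ℕ_)
open import Data.List using (List; length; filter; upTo; drop)
open import Data.Bool.ListAction using (any)
open import Relation.Nullary.Decidable using (does)
open import Relation.Unary using (Decidable)
open import Relation.Binary.PropositionalEquality using (_≡_)
open import Data.Bool.Properties using (_≟_)

modN : ℕ → ℕ → ℕ
modN a zero    = a
modN a (suc n) = a % suc n

modZ : ℤ → ℕ → ℕ
modZ x zero    = ℤ.∣ x ∣
modZ x (suc n) = x %ℕ suc n

isEven : ℕ → Bool
isEven m = modN m 2 ≡ᵇ 0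

isOdd : ℕ → Bool
isOdd m = not (isEven m)

divBy : ℕ → ℕ → Bool
divBy p μ = modN μ p ≡ᵇ 0

isQR : ℕ → ℕ → Bool
isQR p μ = any (λ x → modN (x * x) p ≡ᵇ modN μ p) (upTo p)

legendreIs1 : ℕ → ℕ → Bool
legendreIs1 p μ = not (divBy p μ) ∧ isQR p μ

legendreIsM1 : ℕ → ℕ → Bool
legendreIsM1 p μ = not (divBy p μ) ∧ not (isQR p μ)

range : ℕ → List ℕ
range K = drop 1 (upTo K)

countτ : (ℕ → Bool) → (ℕ → ℕ → Bool) → ℕ → ℤ → ℕ → ℕ
countτ par chi p h K =
  length (filter (λ μ → (not (divBy p μ) ∧ par μ ∧ chi p μ ∧ isOdd (modZ (h ℤ.* + μ) K)) ≟ true)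
                 (range K))

τer τes τor τos : ℕ → ℤ → ℕ → ℕ
τer = countτ isEven legendreIs1
τes = countτ isEven legendreIsM1
τor = countτ isOdd  legendreIs1
τos = countτ isOdd  legendreIsM1

-- The reflection μ ↦ K − μ of the interval (0, K) flips the parity of μ (K is odd), fixes χ_μ
-- (p ∣ K, and χ_{−1} = 1 because p ≡ 1 mod 4), and flips the parity of {hμ}_K, because
-- {hμ}_K + {h(K − μ)}_K = K when (h, K) = 1.  Hence τ_os equals the number of even μ with
-- χ_μ = −1 and {hμ}_K even, so τ_os + τ_es is the number of even μ with χ_μ = −1.  The same
-- reflection shows that these are exactly half of the k(p − 1)/2 non-residues in (0, K), so
-- τ_os + τ_es = k(p − 1)/4 ≡ (p − 1)/4 (mod 2), k being odd.  Residues are treated alike.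
--
-- That −1 is a square modulo p comes from pairing every quadratic residue with its inverse:
-- there are (p − 1)/2 residues, an even number, and 1 is a fixed point of the pairing, so
-- there is another fixed point, and the only candidate is −1.

module Submission where

open import Algebra.Bundles using (CommutativeMonoid)
open import Data.Bool using (Bool; true; false; not; _∧_; T)
open import Data.Bool.ListAction using (any)
open import Data.Bool.Properties using (∧-identityʳ; T-∧; ∧-commutativeMonoid; not-involutive)
import Data.Bool.Properties as Bool
open import Data.Empty using (⊥-elim)
open import Data.Integer as ℤ using (ℤ; ∣_∣)
open import Data.Integer.DivMod using (_%ℕ_; _/ℕ_; a≡a%ℕn+[a/ℕn]*n; n%ℕd<d)
open import Data.Integer.GCD using (gcd)
import Data.Integer.Properties as ℤ
open import Data.Integer.Solver using () renaming (module +-*-Solver to ℤ-Solver)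
open import Data.List using (length; filter; applyUpTo; upTo)
open import Data.List.Membership.Propositional using (find; lose)
open import Data.List.Membership.Propositional.Properties using (∈-upTo⁺)
open import Data.List.Relation.Unary.Any.Properties using (any⁺; any⁻)
open import Data.Nat
open import Data.Nat.Coprimality using (Coprime; coprime-Bézout; coprime-divisor; gcd≡1⇒coprime; prime⇒coprime)
import Data.Nat.Coprimality as Coprimality
open import Data.Nat.DivMod
open import Data.Nat.Divisibility using (_∣_; divides; ∣⇒≤; m%n≡0⇒n∣m; n∣m⇒m%n≡0)
open import Data.Nat.GCD using (module Bézout)
open import Data.Nat.Primality using (Prime; euclidsLemma; prime⇒nonTrivial)
open import Data.Nat.Properties
open import Data.Nat.Solver using (module +-*-Solver)
open import Data.Product using (∃; _×_; _,_; proj₁; proj₂)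
open import Data.Sum using (_⊎_; inj₁; inj₂; [_,_]′)
open import Function using (_∘_; _⇔_; mk⇔; Equivalence)
open import Level using (0ℓ)
open import Relation.Binary.Bundles using (Setoid)
open import Relation.Binary.PropositionalEquality
open import Relation.Nullary using (¬_; yes; no)

open import Defs

𝟙 : Bool → ℕ
𝟙 true  = 1
𝟙 false = 0

∑ : (ℕ → ℕ) → ℕ → ℕ
∑ f zero    = 0
∑ f (suc n) = f 0 + ∑ (f ∘ suc) n

count : (ℕ → Bool) → ℕ → ℕ
count P = ∑ (𝟙 ∘ P)

∑-cong : ∀ n {f g : ℕ → ℕ} → (∀ i → i < n → f i ≡ g i) → ∑ f n ≡ ∑ g n
∑-cong zero    f≗g = refl
∑-cong (suc n) f≗g = cong₂ _+_ (f≗g 0 z<s) (∑-cong n (λ i i<n → f≗g (suc i) (s<s i<n)))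

∑-+ : ∀ n (f g : ℕ → ℕ) → ∑ (λ i → f i + g i) n ≡ ∑ f n + ∑ g n
∑-+ zero    f g = refl
∑-+ (suc n) f g = begin
  (f 0 + g 0) + ∑ (λ i → f (suc i) + g (suc i)) n ≡⟨ cong ((f 0 + g 0) +_) (∑-+ n (f ∘ suc) (g ∘ suc)) ⟩
  (f 0 + g 0) + (∑ (f ∘ suc) n + ∑ (g ∘ suc) n)    ≡⟨ +-+-interchange (f 0) (g 0) _ _ ⟩
  (f 0 + ∑ (f ∘ suc) n) + (g 0 + ∑ (g ∘ suc) n)    ∎
  where open ≡-Reasoning
        open import Algebra.Properties.CommutativeSemigroup +-commutativeSemigroup
          renaming (interchange to +-+-interchange)

∑-const : ∀ n c → ∑ (λ _ → c) n ≡ n * c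
∑-const zero    c = refl
∑-const (suc n) c = cong (c +_) (∑-const n c)

∑-zero : ∀ n {f : ℕ → ℕ} → (∀ i → i < n → f i ≡ 0) → ∑ f n ≡ 0
∑-zero n {f} f≗0 = trans (∑-cong n f≗0) (trans (∑-const n 0) (*-zeroʳ n))

∑-++ : ∀ m n (f : ℕ → ℕ) → ∑ f (m + n) ≡ ∑ f m + ∑ (λ i → f (m + i)) n
∑-++ zero    n f = refl
∑-++ (suc m) n f = trans (cong (f 0 +_) (∑-++ m n (f ∘ suc))) (sym (+-assoc (f 0) _ _))

∑-last : ∀ n (f : ℕ → ℕ) → ∑ f (suc n) ≡ ∑ f n + f n
∑-last zero    f = +-comm (f 0) 0
∑-last (suc n) f = trans (cong (f 0 +_) (∑-last n (f ∘ suc))) (sym (+-assoc (f 0) _ _))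

∑-reverse : ∀ n (f : ℕ → ℕ) → ∑ f n ≡ ∑ (λ i → f (n ∸ suc i)) n
∑-reverse zero    f = refl
∑-reverse (suc n) f = begin
  ∑ f (suc n)                         ≡⟨ ∑-last n f ⟩
  ∑ f n + f n                         ≡⟨ cong (_+ f n) (∑-reverse n f) ⟩
  ∑ (λ i → f (n ∸ suc i)) n + f n     ≡⟨ +-comm _ (f n) ⟩
  f n + ∑ (λ i → f (n ∸ suc i)) n     ∎
  where open ≡-Reasoning

∑-swap : ∀ m n (g : ℕ → ℕ → ℕ) → ∑ (λ i → ∑ (g i) n) m ≡ ∑ (λ j → ∑ (λ i → g i j) m) n
∑-swap zero    n g = sym (∑-zero n (λ _ _ → refl))
∑-swap (suc m) n g = trans (cong (∑ (g 0) n +_) (∑-swap m n (g ∘ suc)))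
                           (sym (∑-+ n (g 0) (λ j → ∑ (λ i → g (suc i) j) m)))

∑-periodic : ∀ k p (f : ℕ → ℕ) → (∀ i → f (p + i) ≡ f i) → ∑ f (k * p) ≡ k * ∑ f p
∑-periodic zero    p f per = refl
∑-periodic (suc k) p f per = begin
  ∑ f (p + k * p)                         ≡⟨ ∑-++ p (k * p) f ⟩
  ∑ f p + ∑ (λ i → f (p + i)) (k * p)     ≡⟨ cong (∑ f p +_) (∑-cong (k * p) (λ i _ → per i)) ⟩
  ∑ f p + ∑ f (k * p)                     ≡⟨ cong (∑ f p +_) (∑-periodic k p f per) ⟩
  ∑ f p + k * ∑ f p                       ∎
  where open ≡-Reasoning

count-none : ∀ n {P : ℕ → Bool} → (∀ i → i < n → ¬ T (P i)) → count P n ≡ 0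
count-none n {P} none = ∑-zero n pointwise
  where
  pointwise : ∀ i → i < n → 𝟙 (P i) ≡ 0
  pointwise i i<n with P i in Pi
  ... | true  = ⊥-elim (none i i<n (subst T (sym Pi) _))
  ... | false = refl

count-unique : ∀ n {P : ℕ → Bool} x → x < n → T (P x) → (∀ i → i < n → T (P i) → i ≡ x) →
               count P n ≡ 1
count-unique (suc n) {P} zero    _         P0 unique with P 0
... | true  = cong suc (count-none n (λ i i<n Pi → 0≢1+n (sym (unique (suc i) (s<s i<n) Pi))))
count-unique (suc n) {P} (suc x) (s<s x<n) Px unique with P 0 in P0
... | true  = ⊥-elim (0≢1+n (unique 0 z<s (subst T (sym P0) _)))
... | false = count-unique n x x<n Px (λ i i<n Pi → suc-injective (unique (suc i) (s<s i<n) Pi))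

count-≡ᵇ : ∀ n x → x < n → count (λ i → i ≡ᵇ x) n ≡ 1
count-≡ᵇ n x x<n = count-unique n x x<n (≡⇒≡ᵇ x x refl) (λ i _ → ≡ᵇ⇒≡ i x)

search : ∀ (P : ℕ → Bool) n → (∃ λ x → x < n × T (P x)) ⊎ (∀ x → x < n → ¬ T (P x))
search P zero    = inj₂ (λ _ ())
search P (suc n) with P 0 in P0 | search (P ∘ suc) n
... | true  | _                    = inj₁ (0 , z<s , subst T (sym P0) _)
... | false | inj₁ (x , x<n , Px)  = inj₁ (suc x , s<s x<n , Px)
... | false | inj₂ none            = inj₂ λ where
  zero    _         P0′ → subst T P0 P0′
  (suc x) (s<s x<n) Px  → none x x<n Px

T-ext : ∀ {a b} → (T a → T b) → (T b → T a) → a ≡ b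
T-ext {true}  {true}  _   _   = refl
T-ext {true}  {false} a⇒b _   = ⊥-elim (a⇒b _)
T-ext {false} {true}  _   b⇒a = ⊥-elim (b⇒a _)
T-ext {false} {false} _   _   = refl

_∖_ : (ℕ → Bool) → ℕ → ℕ → Bool
(S ∖ x) i = S i ∧ not (i ≡ᵇ x)

count-∖ : ∀ n {S : ℕ → Bool} x → x < n → T (S x) → count S n ≡ suc (count (S ∖ x) n)
count-∖ n {S} x x<n Sx = begin
  count S n                                   ≡⟨ ∑-cong n (λ i _ → split i) ⟩
  ∑ (λ i → 𝟙 ((S ∖ x) i) + 𝟙 (i ≡ᵇ x)) n      ≡⟨ ∑-+ n _ _ ⟩
  count (S ∖ x) n + count (λ i → i ≡ᵇ x) n    ≡⟨ cong (count (S ∖ x) n +_) (count-≡ᵇ n x x<n) ⟩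
  count (S ∖ x) n + 1                         ≡⟨ +-comm _ 1 ⟩
  suc (count (S ∖ x) n)                       ∎
  where
  open ≡-Reasoning
  split : ∀ i → 𝟙 (S i) ≡ 𝟙 ((S ∖ x) i) + 𝟙 (i ≡ᵇ x)
  split i with i ≡ᵇ x in i≡x
  ... | false = sym (trans (+-identityʳ _) (cong 𝟙 (∧-identityʳ (S i))))
  ... | true with refl ← ≡ᵇ⇒≡ i x (subst T (sym i≡x) _) with S i
  ...   | true = refl
  ...   | false = ⊥-elim Sx

∖-intro : ∀ {S : ℕ → Bool} {x y} → T (S y) → y ≢ x → T ((S ∖ x) y)
∖-intro {S} {x} {y} Sy y≢x with y ≡ᵇ x in y≡x
... | true  = ⊥-elim (y≢x (≡ᵇ⇒≡ y x (subst T (sym y≡x) _)))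
... | false = subst T (sym (∧-identityʳ (S y))) Sy

∖-elim : ∀ {S : ℕ → Bool} {x y} → T ((S ∖ x) y) → T (S y) × y ≢ x
∖-elim {S} {x} {y} Sy∖x with S y | y ≡ᵇ x in y≡x
... | true | false = _ , λ where refl → subst T y≡x (≡⇒≡ᵇ y y refl)

suc-cong-%2 : ∀ a b → a % 2 ≡ b % 2 → suc a % 2 ≡ suc b % 2
suc-cong-%2 a b a≡b = begin
  (1 + a) % 2           ≡⟨ %-distribˡ-+ 1 a 2 ⟩
  (1 + a % 2) % 2       ≡⟨ cong (λ r → (1 + r) % 2) a≡b ⟩
  (1 + b % 2) % 2       ≡⟨ %-distribˡ-+ 1 b 2 ⟨
  (1 + b) % 2           ∎
  where open ≡-Reasoning

_∩_ : (ℕ → Bool) → (ℕ → Bool) → ℕ → Bool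
(S ∩ F) i = S i ∧ F i

module Involution (N : ℕ) (σ : ℕ → ℕ) where

  Invariant : (ℕ → Bool) → Set
  Invariant S = ∀ x → x < N → T (S x) → σ x < N × T (S (σ x)) × σ (σ x) ≡ x

  Fixed : ℕ → Bool
  Fixed x = σ x ≡ᵇ x

  private
    Fixed⇒≡ : ∀ {x} → T (Fixed x) → σ x ≡ x
    Fixed⇒≡ {x} = ≡ᵇ⇒≡ (σ x) x

    ∖-fixed-invariant : ∀ {S x} → Invariant S → σ x ≡ x → Invariant (S ∖ x)
    ∖-fixed-invariant {S} {x} inv σx≡x y y<N Sy∖x with ∖-elim {S} Sy∖x
    ... | Sy , y≢x with inv y y<N Sy
    ... | σy<N , Sσy , σσy≡y = σy<N , ∖-intro {S} Sσy σy≢x , σσy≡y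
      where σy≢x = λ σy≡x → y≢x (trans (sym σσy≡y) (trans (cong σ σy≡x) σx≡x))

    ∖-orbit-invariant : ∀ {S x} → Invariant S → σ (σ x) ≡ x → Invariant ((S ∖ x) ∖ σ x)
    ∖-orbit-invariant {S} {x} inv σσx≡x y y<N Sy∖∖ with ∖-elim {S ∖ x} Sy∖∖
    ... | Sy∖x , y≢σx with ∖-elim {S} Sy∖x
    ... | Sy , y≢x with inv y y<N Sy
    ... | σy<N , Sσy , σσy≡y = σy<N , ∖-intro {S ∖ x} (∖-intro {S} Sσy σy≢x) σy≢σx , σσy≡y
      where
      σy≢x  = λ σy≡x  → y≢σx (trans (sym σσy≡y) (cong σ σy≡x))
      σy≢σx = λ σy≡σx → y≢x (trans (sym σσy≡y) (trans (cong σ σy≡σx) σσx≡x))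

    count-fixed-∖-fixed : ∀ {S} x → x < N → T (S x) → σ x ≡ x →
                          count (S ∩ Fixed) N ≡ suc (count ((S ∖ x) ∩ Fixed) N)
    count-fixed-∖-fixed {S} x x<N Sx σx≡x =
      trans (count-∖ N x x<N (Equivalence.from T-∧ (Sx , ≡⇒≡ᵇ (σ x) x σx≡x)))
            (cong suc (∑-cong N (λ i _ → cong 𝟙 (∧-interchange (S i) (Fixed i) _))))
      where open import Algebra.Properties.CommutativeSemigroup
                   (CommutativeMonoid.commutativeSemigroup ∧-commutativeMonoid)
              using () renaming (xy∙z≈xz∙y to ∧-interchange)

    count-fixed-∖-orbit : ∀ {S} x → σ x ≢ x → σ (σ x) ≡ x →
                          count (S ∩ Fixed) N ≡ count (((S ∖ x) ∖ σ x) ∩ Fixed) N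
    count-fixed-∖-orbit {S} x σx≢x σσx≡x = ∑-cong N (λ i _ → cong 𝟙 (T-ext (to i) (from i)))
      where
      to : ∀ i → T ((S ∩ Fixed) i) → T ((((S ∖ x) ∖ σ x) ∩ Fixed) i)
      to i Si∩Fi with Si , Fi ← Equivalence.to T-∧ Si∩Fi =
        Equivalence.from T-∧ (∖-intro {S ∖ x} (∖-intro {S} Si i≢x) i≢σx , Fi)
        where
        i≢x  = λ where refl → σx≢x (Fixed⇒≡ Fi)
        i≢σx = λ where refl → σx≢x (trans (sym (Fixed⇒≡ Fi)) σσx≡x)
      from : ∀ i → T ((((S ∖ x) ∖ σ x) ∩ Fixed) i) → T ((S ∩ Fixed) i)
      from i Si∖∖∩Fi with Si∖∖ , Fi ← Equivalence.to T-∧ Si∖∖∩Fi =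
        Equivalence.from T-∧ (proj₁ (∖-elim {S} (proj₁ (∖-elim {S ∖ x} Si∖∖))) , Fi)

    -- Remove a fixed point, or an orbit {x, σ x} of size two, and recurse.
    parity-by-fuel : ∀ fuel S → Invariant S → count S N ≤ fuel →
                     count S N % 2 ≡ count (S ∩ Fixed) N % 2
    parity-by-fuel fuel S inv bound with search S N
    ... | inj₂ none = cong (_% 2) (trans (count-none N none)
                        (sym (count-none N (λ i i<N → none i i<N ∘ proj₁ ∘ Equivalence.to T-∧))))
    ... | inj₁ (x , x<N , Sx) with inv x x<N Sx | σ x ≟ x | fuel
    ...   | _ | _ | zero = ⊥-elim (<⇒≱ (subst (0 <_) (sym (count-∖ N x x<N Sx)) z<s) bound)
    ...   | _ | yes σx≡x | suc fuel = begin
      count S N % 2                          ≡⟨ cong (_% 2) (count-∖ N x x<N Sx) ⟩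
      suc (count (S ∖ x) N) % 2              ≡⟨ suc-cong-%2 (count (S ∖ x) N) (count ((S ∖ x) ∩ Fixed) N) ih ⟩
      suc (count ((S ∖ x) ∩ Fixed) N) % 2    ≡⟨ cong (_% 2) (count-fixed-∖-fixed x x<N Sx σx≡x) ⟨
      count (S ∩ Fixed) N % 2                ∎
      where
      open ≡-Reasoning
      ih = parity-by-fuel fuel (S ∖ x) (∖-fixed-invariant inv σx≡x)
                          (s≤s⁻¹ (subst (_≤ suc fuel) (count-∖ N x x<N Sx) bound))
    ...   | σx<N , Sσx , σσx≡x | no σx≢x | suc fuel = begin
      count S N % 2               ≡⟨ cong (_% 2) count-S ⟩
      (count S′ N + 2) % 2        ≡⟨ [m+n]%n≡m%n (count S′ N) 2 ⟩
      count S′ N % 2              ≡⟨ parity-by-fuel fuel S′ (∖-orbit-invariant inv σσx≡x) bound′ ⟩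
      count (S′ ∩ Fixed) N % 2    ≡⟨ cong (_% 2) (count-fixed-∖-orbit x σx≢x σσx≡x) ⟨
      count (S ∩ Fixed) N % 2     ∎
      where
      open ≡-Reasoning
      S′ = (S ∖ x) ∖ σ x
      count-S : count S N ≡ count S′ N + 2
      count-S = trans (count-∖ N x x<N Sx)
                (trans (cong suc (count-∖ N (σ x) σx<N (∖-intro {S} Sσx σx≢x))) (+-comm 2 _))
      bound′ : count S′ N ≤ fuel
      bound′ = ≤-trans (m≤m+n (count S′ N) 1)
                 (s≤s⁻¹ (subst (_≤ suc fuel) (trans count-S (+-suc (count S′ N) 1)) bound))

  count-involution-parity : ∀ S → Invariant S → count S N % 2 ≡ count (S ∩ Fixed) N % 2
  count-involution-parity S inv = parity-by-fuel (count S N) S inv ≤-refl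

length-filter-applyUpTo : ∀ (P : ℕ → Bool) f n →
                          length (filter (λ x → P x Bool.≟ true) (applyUpTo f n)) ≡ count (P ∘ f) n
length-filter-applyUpTo P f zero    = refl
length-filter-applyUpTo P f (suc n) with P (f 0)
... | true  = cong suc (length-filter-applyUpTo P (f ∘ suc) n)
... | false = length-filter-applyUpTo P (f ∘ suc) n

module Modulo (p′ : ℕ) where

  p : ℕ
  p = suc p′

  -- A record rather than the bare equation, so that a and b can be inferred from a proof.
  infix 4 _≈_
  record _≈_ (a b : ℕ) : Set where
    constructor mk≈
    field %≡% : a % p ≡ b % p
  open _≈_ public

  ≈-reflexive : ∀ {a b} → a ≡ b → a ≈ b
  ≈-reflexive refl = mk≈ refl

  ≈-refl : ∀ {a} → a ≈ a
  ≈-refl = mk≈ refl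

  ≈-sym : ∀ {a b} → a ≈ b → b ≈ a
  ≈-sym (mk≈ e) = mk≈ (sym e)

  ≈-trans : ∀ {a b c} → a ≈ b → b ≈ c → a ≈ c
  ≈-trans (mk≈ e) (mk≈ f) = mk≈ (trans e f)

  ≈-setoid : Setoid 0ℓ 0ℓ
  ≈-setoid = record
    { Carrier = ℕ ; _≈_ = _≈_
    ; isEquivalence = record { refl = ≈-refl ; sym = ≈-sym ; trans = ≈-trans } }

  module ≈-Reasoning where
    open import Relation.Binary.Reasoning.Setoid ≈-setoid public

  +-cong : ∀ {a b c d} → a ≈ b → c ≈ d → a + c ≈ b + d
  +-cong {a} {b} {c} {d} (mk≈ a≈b) (mk≈ c≈d) = mk≈ (begin
    (a + c) % p            ≡⟨ %-distribˡ-+ a c p ⟩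
    (a % p + c % p) % p    ≡⟨ cong₂ (λ u v → (u + v) % p) a≈b c≈d ⟩
    (b % p + d % p) % p    ≡⟨ %-distribˡ-+ b d p ⟨
    (b + d) % p            ∎)
    where open ≡-Reasoning

  *-cong : ∀ {a b c d} → a ≈ b → c ≈ d → a * c ≈ b * d
  *-cong {a} {b} {c} {d} (mk≈ a≈b) (mk≈ c≈d) = mk≈ (begin
    (a * c) % p            ≡⟨ %-distribˡ-* a c p ⟩
    (a % p * (c % p)) % p  ≡⟨ cong₂ (λ u v → (u * v) % p) a≈b c≈d ⟩
    (b % p * (d % p)) % p  ≡⟨ %-distribˡ-* b d p ⟨
    (b * d) % p            ∎)
    where open ≡-Reasoning

  %≈ : ∀ a → a % p ≈ a
  %≈ a = mk≈ (m%n%n≡m%n a p)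

  +-*p≈ : ∀ a k → a + k * p ≈ a
  +-*p≈ a k = mk≈ ([m+kn]%n≡m%n a k p)

  *p≈0 : ∀ k → k * p ≈ 0
  *p≈0 = +-*p≈ 0

  p≈0 : p ≈ 0
  p≈0 = ≈-trans (≈-reflexive (sym (*-identityˡ p))) (*p≈0 1)

  p+≈ : ∀ a → p + a ≈ a
  p+≈ a = +-cong p≈0 (≈-refl {a})

  +-cancelʳ-≈ : ∀ {a b} c → a + c ≈ b + c → a ≈ b
  +-cancelʳ-≈ {a} {b} c a+c≈b+c = begin
    a                  ≈⟨ +-*p≈ a c ⟨
    a + c * p          ≡⟨ shift a ⟩
    (a + c) + p′ * c   ≈⟨ +-cong a+c≈b+c (≈-refl {p′ * c}) ⟩
    (b + c) + p′ * c   ≡⟨ shift b ⟨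
    b + c * p          ≈⟨ +-*p≈ b c ⟩
    b                  ∎
    where
    open ≈-Reasoning
    shift : ∀ x → x + c * p ≡ (x + c) + p′ * c
    shift x = trans (cong (x +_) (*-comm c p)) (sym (+-assoc x c (p′ * c)))

  +-cancelˡ-≈ : ∀ {a b} c → c + a ≈ c + b → a ≈ b
  +-cancelˡ-≈ {a} {b} c c+a≈c+b =
    +-cancelʳ-≈ c (≈-trans (≈-reflexive (+-comm a c)) (≈-trans c+a≈c+b (≈-reflexive (+-comm c b))))

  ≈0⇒∣ : ∀ {a} → a ≈ 0 → p ∣ a
  ≈0⇒∣ {a} (mk≈ a%p≡0) = m%n≡0⇒n∣m a p a%p≡0

  ∣⇒≈0 : ∀ {a} → p ∣ a → a ≈ 0
  ∣⇒≈0 {a} p∣a = mk≈ (n∣m⇒m%n≡0 a p p∣a)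

  ≈⇒≡ : ∀ {a b} → a < p → b < p → a ≈ b → a ≡ b
  ≈⇒≡ a<p b<p (mk≈ a≈b) = trans (sym (m<n⇒m%n≡m a<p)) (trans a≈b (m<n⇒m%n≡m b<p))

  square-neg : ∀ {x y} → x + y ≈ 0 → x * x ≈ y * y
  square-neg {x} {y} x+y≈0 = +-cancelʳ-≈ (x * y) (begin
    x * x + x * y     ≡⟨ *-distribˡ-+ x x y ⟨
    x * (x + y)       ≈⟨ *-cong (≈-refl {x}) x+y≈0 ⟩
    x * 0             ≡⟨ trans (*-zeroʳ x) (sym (*-zeroˡ y)) ⟩
    0 * y             ≈⟨ *-cong x+y≈0 (≈-refl {y}) ⟨
    (x + y) * y       ≡⟨ trans (*-distribʳ-+ y x y) (+-comm (x * y) (y * y)) ⟩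
    y * y + x * y     ∎)
    where open ≈-Reasoning

  module PrimeModulus (prime : Prime p) where

    1<p : 1 < p
    1<p = nonTrivial⇒n>1 p {{prime⇒nonTrivial prime}}

    1≉0 : ¬ 1 ≈ 0
    1≉0 (mk≈ 1%p≡0) = 1≢0 (trans (sym (m<n⇒m%n≡m 1<p)) 1%p≡0)
      where 1≢0 : 1 ≢ 0
            1≢0 ()

    *≈0⇒ : ∀ {x y} → x * y ≈ 0 → x ≈ 0 ⊎ y ≈ 0
    *≈0⇒ {x} {y} xy≈0 with euclidsLemma x y prime (≈0⇒∣ xy≈0)
    ... | inj₁ p∣x = inj₁ (∣⇒≈0 p∣x)
    ... | inj₂ p∣y = inj₂ (∣⇒≈0 p∣y)

    private
      *-cancelˡ-≈-≤ : ∀ {x u v} → ¬ x ≈ 0 → u ≤ v → x * v ≈ x * u → v ≈ u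
      *-cancelˡ-≈-≤ {x} {u} x≉0 u≤v xv≈xu with d , refl ← m≤n⇒∃[o]m+o≡n u≤v =
        [ ⊥-elim ∘ x≉0 , (λ d≈0 → begin
            u + d   ≈⟨ +-cong (≈-refl {u}) d≈0 ⟩
            u + 0   ≡⟨ +-identityʳ u ⟩
            u       ∎) ]′ (*≈0⇒ xd≈0)
        where
        open ≈-Reasoning
        xd≈0 : x * d ≈ 0
        xd≈0 = +-cancelˡ-≈ (x * u) (begin
          x * u + x * d   ≡⟨ *-distribˡ-+ x u d ⟨
          x * (u + d)     ≈⟨ xv≈xu ⟩
          x * u           ≡⟨ +-identityʳ (x * u) ⟨
          x * u + 0       ∎)

    *-cancelˡ-≈ : ∀ {x y z} → ¬ x ≈ 0 → x * y ≈ x * z → y ≈ z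
    *-cancelˡ-≈ {x} {y} {z} x≉0 xy≈xz with ≤-total z y
    ... | inj₁ z≤y = *-cancelˡ-≈-≤ x≉0 z≤y xy≈xz
    ... | inj₂ y≤z = ≈-sym (*-cancelˡ-≈-≤ x≉0 y≤z (≈-sym xy≈xz))

    private
      square-≈-≤ : ∀ {x y} → y ≤ x → x * x ≈ y * y → x ≈ y ⊎ x + y ≈ 0
      square-≈-≤ {y = y} y≤x xx≈yy with d , refl ← m≤n⇒∃[o]m+o≡n y≤x with *≈0⇒ dd2y≈0
        where
        open ≈-Reasoning
        open +-*-Solver
        expand : (y + d) * (y + d) ≡ y * y + d * (d + y + y)
        expand = solve 2 (λ y d → (y :+ d) :* (y :+ d) := y :* y :+ d :* (d :+ y :+ y)) refl y d
        dd2y≈0 : d * (d + y + y) ≈ 0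
        dd2y≈0 = +-cancelˡ-≈ (y * y) (begin
          y * y + d * (d + y + y)   ≡⟨ expand ⟨
          (y + d) * (y + d)         ≈⟨ xx≈yy ⟩
          y * y                     ≡⟨ +-identityʳ (y * y) ⟨
          y * y + 0                 ∎)
      ... | inj₁ d≈0    = inj₁ (≈-trans (+-cong (≈-refl {y}) d≈0) (≈-reflexive (+-identityʳ y)))
      ... | inj₂ d2y≈0  = inj₂ (≈-trans (≈-reflexive x+y≡d+y+y) d2y≈0)
        where
        open +-*-Solver
        x+y≡d+y+y : (y + d) + y ≡ d + y + y
        x+y≡d+y+y = solve 2 (λ y d → (y :+ d) :+ y := d :+ y :+ y) refl y d

    square-≈ : ∀ {x y} → x * x ≈ y * y → x ≈ y ⊎ x + y ≈ 0
    square-≈ {x} {y} xx≈yy with ≤-total y x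
    ... | inj₁ y≤x = square-≈-≤ y≤x xx≈yy
    ... | inj₂ x≤y with square-≈-≤ x≤y (≈-sym xx≈yy)
    ...   | inj₁ y≈x    = inj₁ (≈-sym y≈x)
    ...   | inj₂ y+x≈0  = inj₂ (≈-trans (≈-reflexive (+-comm x y)) y+x≈0)


    private
      bézout-inverse : ∀ {a} → ¬ a ≈ 0 → ∃ λ b → a * b ≈ 1
      bézout-inverse {a} a≉0 =
        from-bézout (coprime-Bézout (prime⇒coprime prime {{≢-nonZero r≢0}} (m%n<n a p)))
        where
        open ≈-Reasoning
        open +-*-Solver
        r = a % p
        r≢0 : r ≢ 0
        r≢0 r≡0 = a≉0 (mk≈ r≡0)
        from-bézout : Bézout.Identity 1 p r → ∃ λ b → a * b ≈ 1
        from-bézout (Bézout.-+ x y eq) = y , (begin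
          a * y        ≈⟨ *-cong (%≈ a) (≈-refl {y}) ⟨
          r * y        ≡⟨ trans (*-comm r y) (sym eq) ⟩
          1 + x * p    ≈⟨ +-*p≈ 1 x ⟩
          1            ∎)
        -- Here r y ≡ −1, so y (p − 1) inverts r.
        from-bézout (Bézout.+- x y eq) = y * p′ , +-cancelʳ-≈ p′ (begin
          a * (y * p′) + p′   ≈⟨ +-cong (*-cong (%≈ a) (≈-refl {y * p′})) (≈-refl {p′}) ⟨
          r * (y * p′) + p′   ≡⟨ solve 3 (λ r y p′ → r :* (y :* p′) :+ p′ := (con 1 :+ y :* r) :* p′)
                                         refl r y p′ ⟩
          (1 + y * r) * p′    ≡⟨ cong (_* p′) eq ⟩
          x * p * p′          ≡⟨ solve 3 (λ x p p′ → x :* p :* p′ := x :* p′ :* p) refl x p p′ ⟩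
          x * p′ * p          ≈⟨ *p≈0 (x * p′) ⟩
          0                   ≈⟨ p≈0 ⟨
          1 + p′              ∎)

    -- Junk value 0 when a ≡ 0 (mod p).
    inverse : ℕ → ℕ
    inverse a with search (λ b → (a * b) % p ≡ᵇ 1 % p) p
    ... | inj₁ (b , _) = b
    ... | inj₂ _       = 0

    inverse-spec : ∀ {a} → ¬ a ≈ 0 → inverse a < p × a * inverse a ≈ 1
    inverse-spec {a} a≉0 with search (λ b → (a * b) % p ≡ᵇ 1 % p) p
    ... | inj₁ (b , b<p , ab≡1) = b<p , mk≈ (≡ᵇ⇒≡ _ _ ab≡1)
    ... | inj₂ none with b , ab≈1 ← bézout-inverse a≉0 =
      ⊥-elim (none (b % p) (m%n<n b p) (≡⇒≡ᵇ _ _ (%≡% (≈-trans (*-cong (≈-refl {a}) (%≈ b)) ab≈1))))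

    inverse≉0 : ∀ {a} → ¬ a ≈ 0 → ¬ inverse a ≈ 0
    inverse≉0 {a} a≉0 inverse≈0 = 1≉0 (begin
      1                 ≈⟨ proj₂ (inverse-spec a≉0) ⟨
      a * inverse a     ≈⟨ *-cong (≈-refl {a}) inverse≈0 ⟩
      a * 0             ≡⟨ *-zeroʳ a ⟩
      0                 ∎)
      where open ≈-Reasoning

    inverse-unique : ∀ {a b} → ¬ a ≈ 0 → b < p → a * b ≈ 1 → inverse a ≡ b
    inverse-unique {a} a≉0 b<p ab≈1 = ≈⇒≡ (proj₁ (inverse-spec a≉0)) b<p
      (*-cancelˡ-≈ a≉0 (≈-trans (proj₂ (inverse-spec a≉0)) (≈-sym ab≈1)))

    inverse-involutive : ∀ {a} → a < p → ¬ a ≈ 0 → inverse (inverse a) ≡ a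
    inverse-involutive {a} a<p a≉0 = inverse-unique (inverse≉0 a≉0) a<p
      (≈-trans (≈-reflexive (*-comm (inverse a) a)) (proj₂ (inverse-spec a≉0)))

module Residues (p′ : ℕ) where
  open Modulo p′

  Square : ℕ → Set
  Square a = ∃ λ x → x * x ≈ a

  Square-resp-≈ : ∀ {a b} → a ≈ b → Square a → Square b
  Square-resp-≈ a≈b (x , xx≈a) = x , ≈-trans xx≈a a≈b

  T-isQR⇔Square : ∀ a → T (isQR p a) ⇔ Square a
  T-isQR⇔Square a = mk⇔ to from
    where
    to : T (isQR p a) → Square a
    to isQR with x , _ , xx≡a ← find (any⁻ _ (upTo p) isQR) = x , mk≈ (≡ᵇ⇒≡ _ _ xx≡a)
    from : Square a → T (isQR p a)
    from (x , xx≈a) = any⁺ _ (lose (∈-upTo⁺ (m%n<n x p))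
      (≡⇒≡ᵇ _ _ (%≡% (≈-trans (*-cong (%≈ x) (%≈ x)) xx≈a))))

  T-divBy⇔≈0 : ∀ a → T (divBy p a) ⇔ a ≈ 0
  T-divBy⇔≈0 a = mk⇔ (mk≈ ∘ ≡ᵇ⇒≡ _ _) (≡⇒≡ᵇ _ _ ∘ %≡%)

  T-legendreIs1⇔ : ∀ a → T (legendreIs1 p a) ⇔ (¬ a ≈ 0 × Square a)
  T-legendreIs1⇔ a = mk⇔
    (λ χa → let ¬pa , qa = T-not∧ χa in ¬pa ∘ from (T-divBy⇔≈0 a) , to (T-isQR⇔Square a) qa)
    (λ (a≉0 , sq) → T-not∧⁻ (a≉0 ∘ to (T-divBy⇔≈0 a)) (from (T-isQR⇔Square a) sq))
    where
    open Equivalence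
    T-not∧ : ∀ {b c} → T (not b ∧ c) → ¬ T b × T c
    T-not∧ {false} {true} _ = (λ ()) , _
    T-not∧⁻ : ∀ {b c} → ¬ T b → T c → T (not b ∧ c)
    T-not∧⁻ {false} {true} _ _ = _
    T-not∧⁻ {true}         ¬b _ = ¬b _

  legendreIs1-cong : ∀ {a b} → a ≈ b → legendreIs1 p a ≡ legendreIs1 p b
  legendreIs1-cong (mk≈ a≡b) = cong (λ r → not (r ≡ᵇ 0) ∧ any (λ x → (x * x) % p ≡ᵇ r) (upTo p)) a≡b

  legendreIsM1-cong : ∀ {a b} → a ≈ b → legendreIsM1 p a ≡ legendreIsM1 p b
  legendreIsM1-cong (mk≈ a≡b) =
    cong (λ r → not (r ≡ᵇ 0) ∧ not (any (λ x → (x * x) % p ≡ᵇ r) (upTo p))) a≡b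

  MinusOneSquare : Set
  MinusOneSquare = ∃ λ i → i * i + 1 ≈ 0

  Square-neg : MinusOneSquare → ∀ {a b} → a + b ≈ 0 → Square a → Square b
  Square-neg (i , ii+1≈0) {a} {b} a+b≈0 (x , xx≈a) = i * x , +-cancelʳ-≈ a (begin
    i * x * (i * x) + a        ≈⟨ +-cong (≈-refl {i * x * (i * x)}) xx≈a ⟨
    i * x * (i * x) + x * x    ≡⟨ solve 2 (λ i x → i :* x :* (i :* x) :+ x :* x := (i :* i :+ con 1) :* (x :* x))
                                        refl i x ⟩
    (i * i + 1) * (x * x)      ≈⟨ *-cong ii+1≈0 (≈-refl {x * x}) ⟩
    0                          ≈⟨ a+b≈0 ⟨
    a + b                      ≡⟨ +-comm a b ⟩
    b + a                      ∎)
    where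
    open ≈-Reasoning
    open +-*-Solver

  +≈0⇒≈0 : ∀ {a b} → a + b ≈ 0 → a ≈ 0 → b ≈ 0
  +≈0⇒≈0 {a} {b} a+b≈0 a≈0 =
    +-cancelˡ-≈ a (≈-trans a+b≈0 (≈-trans (≈-sym a≈0) (≈-reflexive (sym (+-identityʳ a)))))

  module _ (i²≈-1 : MinusOneSquare) {a b : ℕ} (a+b≈0 : a + b ≈ 0) where
    private
      b+a≈0 : b + a ≈ 0
      b+a≈0 = ≈-trans (≈-reflexive (+-comm b a)) a+b≈0

      divBy-neg : divBy p a ≡ divBy p b
      divBy-neg = T-ext (from (T-divBy⇔≈0 b) ∘ +≈0⇒≈0 a+b≈0 ∘ to (T-divBy⇔≈0 a))
                        (from (T-divBy⇔≈0 a) ∘ +≈0⇒≈0 b+a≈0 ∘ to (T-divBy⇔≈0 b))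
        where open Equivalence

      isQR-neg : isQR p a ≡ isQR p b
      isQR-neg = T-ext (from (T-isQR⇔Square b) ∘ Square-neg i²≈-1 a+b≈0 ∘ to (T-isQR⇔Square a))
                       (from (T-isQR⇔Square a) ∘ Square-neg i²≈-1 b+a≈0 ∘ to (T-isQR⇔Square b))
        where open Equivalence

    legendreIs1-neg : legendreIs1 p a ≡ legendreIs1 p b
    legendreIs1-neg = cong₂ (λ d q → not d ∧ q) divBy-neg isQR-neg

    legendreIsM1-neg : legendreIsM1 p a ≡ legendreIsM1 p b
    legendreIsM1-neg = cong₂ (λ d q → not d ∧ not q) divBy-neg isQR-neg

module OddPrime (m : ℕ) (prime : Prime (suc (m + m))) where
  open Modulo (m + m)
  open PrimeModulus prime
  open Residues (m + m)
  open Equivalence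

  m<p : m < p
  m<p = s≤s (m≤m+n m m)

  fold-root : ∀ {r} → 0 < r → r < p → ∃ λ y → 0 < y × y ≤ m × y * y ≈ r * r
  fold-root {r} 0<r r<p with r ≤? m
  ... | yes r≤m = r , 0<r , r≤m , ≈-refl
  ... | no r≰m  = p ∸ r , m<n⇒0<n∸m r<p , p∸r≤m , square-neg {p ∸ r} {r} p∸r+r≈0
    where
    p∸r≤m : p ∸ r ≤ m
    p∸r≤m = ≤-trans (∸-monoʳ-≤ p (≰⇒> r≰m)) (≤-reflexive (m+n∸n≡m m m))
    p∸r+r≈0 : p ∸ r + r ≈ 0
    p∸r+r≈0 = ≈-trans (≈-reflexive (m∸n+n≡m (<⇒≤ r<p))) p≈0

  half-root : ∀ {a} → ¬ a ≈ 0 → Square a → ∃ λ y → 0 < y × y ≤ m × y * y ≈ a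
  half-root {a} a≉0 (x , xx≈a) =
    let y , 0<y , y≤m , yy≈rr = fold-root 0<r (m%n<n x p)
    in  y , 0<y , y≤m , ≈-trans yy≈rr (≈-trans (*-cong (%≈ x) (%≈ x)) xx≈a)
    where
    0<r : 0 < x % p
    0<r = n≢0⇒n>0 λ r≡0 → a≉0 (≈-trans (≈-sym xx≈a) (*-cong (x≈0 r≡0) (x≈0 r≡0)))
      where x≈0 : x % p ≡ 0 → x ≈ 0
            x≈0 = mk≈

  half-unique : ∀ {x y} → 0 < x → x ≤ m → y ≤ m → x * x ≈ y * y → x ≡ y
  half-unique {x} {y} 0<x x≤m y≤m xx≈yy with square-≈ xx≈yy
  ... | inj₁ x≈y   = ≈⇒≡ (≤-<-trans x≤m m<p) (≤-<-trans y≤m m<p) x≈y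
  ... | inj₂ x+y≈0 =
    ⊥-elim (<⇒≢ (≤-trans 0<x (m≤m+n x y)) (sym (≈⇒≡ (s≤s (+-mono-≤ x≤m y≤m)) z<s x+y≈0)))

  private
    square-index : ℕ → ℕ
    square-index x = (suc x * suc x) % p

    square-index-≡ : ∀ {a} x → T (a ≡ᵇ square-index x) → suc x * suc x ≈ a
    square-index-≡ {a} x a≡ = ≈-trans (≈-sym (%≈ (suc x * suc x))) (≈-reflexive (sym (≡ᵇ⇒≡ a _ a≡)))

    count-square-roots : ∀ a → a < p → ¬ a ≈ 0 → Square a → count (λ x → a ≡ᵇ square-index x) m ≡ 1
    count-square-roots a a<p a≉0 sq with half-root a≉0 sq
    ... | suc x₀ , _ , y≤m , yy≈a = count-unique m x₀ y≤m (≡⇒≡ᵇ a (square-index x₀) a≡) unique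
      where
      a≡ : a ≡ square-index x₀
      a≡ = ≈⇒≡ a<p (m%n<n (suc x₀ * suc x₀) p)
                 (≈-trans (≈-sym yy≈a) (≈-sym (%≈ (suc x₀ * suc x₀))))
      unique : ∀ x → x < m → T (a ≡ᵇ square-index x) → x ≡ x₀
      unique x x<m a≡ = suc-injective (half-unique z<s x<m y≤m (≈-trans (square-index-≡ x a≡) (≈-sym yy≈a)))

    square≉0 : ∀ x → x < m → ¬ suc x * suc x ≈ 0
    square≉0 x x<m xx≈0 = [ x≉0 , x≉0 ]′ (*≈0⇒ xx≈0)
      where x≉0 = λ x≈0 → 0≢1+n (sym (≈⇒≡ (≤-<-trans x<m m<p) z<s x≈0))

    𝟙-legendreIs1 : ∀ a → a < p → 𝟙 (legendreIs1 p a) ≡ count (λ x → a ≡ᵇ square-index x) m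
    𝟙-legendreIs1 a a<p with legendreIs1 p a in χa
    ... | true  = let a≉0 , sq = to (T-legendreIs1⇔ a) (subst T (sym χa) _)
                  in sym (count-square-roots a a<p a≉0 sq)
    ... | false = sym (count-none m λ x x<m a≡ → subst T χa (from (T-legendreIs1⇔ a)
                    ( (λ a≈0 → square≉0 x x<m (≈-trans (square-index-≡ x a≡) a≈0))
                    , (suc x , square-index-≡ x a≡))))

  count-legendreIs1 : count (legendreIs1 p) p ≡ m
  count-legendreIs1 = begin
    count (legendreIs1 p) p
      ≡⟨ ∑-cong p 𝟙-legendreIs1 ⟩
    ∑ (λ a → count (λ x → a ≡ᵇ square-index x) m) p
      ≡⟨ ∑-swap p m (λ a x → 𝟙 (a ≡ᵇ square-index x)) ⟩
    ∑ (λ x → count (λ a → a ≡ᵇ square-index x) p) m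
      ≡⟨ ∑-cong m (λ x _ → count-≡ᵇ p (square-index x) (m%n<n (suc x * suc x) p)) ⟩
    ∑ (λ _ → 1) m
      ≡⟨ trans (∑-const m 1) (*-identityʳ m) ⟩
    m ∎
    where open ≡-Reasoning

  count-not-divBy : count (not ∘ divBy p) p ≡ m + m
  count-not-divBy = begin
    count (not ∘ divBy p) p
      ≡⟨ ∑-cong (m + m) (λ j j<2m → cong (𝟙 ∘ not ∘ (_≡ᵇ 0)) (m<n⇒m%n≡m (s≤s j<2m))) ⟩
    ∑ (λ _ → 1) (m + m)
      ≡⟨ trans (∑-const (m + m) 1) (*-identityʳ (m + m)) ⟩
    m + m ∎
    where open ≡-Reasoning

  count-legendreIsM1 : count (legendreIsM1 p) p ≡ m
  count-legendreIsM1 = +-cancelˡ-≡ m _ m (begin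
    m + count (legendreIsM1 p) p
      ≡⟨ cong (_+ count (legendreIsM1 p) p) count-legendreIs1 ⟨
    count (legendreIs1 p) p + count (legendreIsM1 p) p
      ≡⟨ ∑-+ p (𝟙 ∘ legendreIs1 p) (𝟙 ∘ legendreIsM1 p) ⟨
    ∑ (λ a → 𝟙 (legendreIs1 p a) + 𝟙 (legendreIsM1 p a)) p
      ≡⟨ ∑-cong p (λ a _ → units a) ⟩
    count (not ∘ divBy p) p
      ≡⟨ count-not-divBy ⟩
    m + m ∎)
    where
    open ≡-Reasoning
    units : ∀ a → 𝟙 (legendreIs1 p a) + 𝟙 (legendreIsM1 p a) ≡ 𝟙 (not (divBy p a))
    units a with divBy p a | isQR p a
    ... | true  | _     = refl
    ... | false | true  = refl
    ... | false | false = refl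

  private
    module Inv = Involution p inverse

    Square-inverse : ∀ {a} → ¬ a ≈ 0 → Square a → Square (inverse a)
    Square-inverse {a} a≉0 (r , rr≈a) = inverse r , ≈-sym (*-cancelˡ-≈ a≉0 (begin
      a * inverse a                          ≈⟨ proj₂ (inverse-spec a≉0) ⟩
      1 * 1                                  ≈⟨ *-cong r·r⁻¹≈1 r·r⁻¹≈1 ⟨
      (r * inverse r) * (r * inverse r)      ≡⟨ *-*-interchange r (inverse r) r (inverse r) ⟩  
      (r * r) * (inverse r * inverse r)      ≈⟨ *-cong rr≈a (≈-refl {inverse r * inverse r}) ⟩
      a * (inverse r * inverse r)            ∎))
      where
      open ≈-Reasoning
      r≉0 : ¬ r ≈ 0
      r≉0 r≈0 = a≉0 (≈-trans (≈-sym rr≈a) (*-cong r≈0 r≈0))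
      r·r⁻¹≈1 = proj₂ (inverse-spec r≉0)
      open import Algebra.Properties.CommutativeSemigroup *-commutativeSemigroup
        using () renaming (interchange to *-*-interchange)

    legendreIs1-inverse-invariant : Inv.Invariant (legendreIs1 p)
    legendreIs1-inverse-invariant a a<p χa =
      let a≉0 , sq = to (T-legendreIs1⇔ a) χa in
      proj₁ (inverse-spec a≉0) ,
      from (T-legendreIs1⇔ (inverse a)) (inverse≉0 a≉0 , Square-inverse a≉0 sq) ,
      inverse-involutive a<p a≉0

    count-fixed-residues : ¬ Square (m + m) → count (legendreIs1 p ∩ Inv.Fixed) p ≡ 1
    count-fixed-residues ¬sq = count-unique p 1 1<p
      (from T-∧ (from (T-legendreIs1⇔ 1) (1≉0 , 1 , ≈-refl) , ≡⇒≡ᵇ _ _ inverse-1))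
      unique
      where
      inverse-1 : inverse 1 ≡ 1
      inverse-1 = inverse-unique 1≉0 1<p ≈-refl
      unique : ∀ a → a < p → T ((legendreIs1 p ∩ Inv.Fixed) a) → a ≡ 1
      unique a a<p χa∧fixed with χa , fixed ← to T-∧ χa∧fixed with a≉0 , sq ← to (T-legendreIs1⇔ a) χa
        with square-≈ {a} {1} (subst (λ b → a * b ≈ 1) (≡ᵇ⇒≡ _ _ fixed) (proj₂ (inverse-spec a≉0)))
      ... | inj₁ a≈1   = ≈⇒≡ a<p 1<p a≈1
      ... | inj₂ a+1≈0 = ⊥-elim (¬sq (Square-resp-≈ (+-cancelʳ-≈ 1 a+1≈-1) sq))
        where a+1≈-1 : a + 1 ≈ m + m + 1
              a+1≈-1 = ≈-trans a+1≈0 (≈-trans (≈-sym p≈0) (≈-reflexive (+-comm 1 (m + m))))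

  minus-one-square : m % 2 ≡ 0 → MinusOneSquare
  minus-one-square m-even with isQR p (m + m) in qr
  ... | true  = let i , ii≈-1 = to (T-isQR⇔Square (m + m)) (subst T (sym qr) _)
                in i , ≈-trans (+-cong ii≈-1 (≈-refl {1})) (≈-trans (≈-reflexive (+-comm (m + m) 1)) p≈0)
  ... | false = ⊥-elim (0≢1+n (begin
      0                                            ≡⟨ m-even ⟨
      m % 2                                        ≡⟨ cong (_% 2) count-legendreIs1 ⟨
      count (legendreIs1 p) p % 2                  ≡⟨ Inv.count-involution-parity (legendreIs1 p)
                                                                                    legendreIs1-inverse-invariant ⟩
      count (legendreIs1 p ∩ Inv.Fixed) p % 2      ≡⟨ cong (_% 2) (count-fixed-residues ¬sq) ⟩
      1                                            ∎))
    where
    open ≡-Reasoning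
    ¬sq : ¬ Square (m + m)
    ¬sq sq = subst T qr (from (T-isQR⇔Square (m + m)) sq)

module _ where
  open import Data.Integer using (+_)

  residues-sum-multiple : ∀ (X Y c : ℤ) K .{{_ : NonZero K}} → X ℤ.+ Y ≡ c ℤ.* + K →
                          ∃ λ t → X %ℕ K + Y %ℕ K ≡ t * K
  residues-sum-multiple X Y c K X+Y≡cK = ∣ c ℤ.- x ℤ.- y ∣ , (begin
    r + s                           ≡⟨ cong ∣_∣ +r+s≡[c-x-y]K ⟩
    ∣ (c ℤ.- x ℤ.- y) ℤ.* + K ∣     ≡⟨ ℤ.abs-* (c ℤ.- x ℤ.- y) (+ K) ⟩
    ∣ c ℤ.- x ℤ.- y ∣ * K           ∎)
    where
    open ≡-Reasoning
    open ℤ-Solver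
    r = X %ℕ K
    s = Y %ℕ K
    x = X /ℕ K
    y = Y /ℕ K
    +r+s≡[c-x-y]K : + (r + s) ≡ (c ℤ.- x ℤ.- y) ℤ.* + K
    +r+s≡[c-x-y]K = begin
      + (r + s)
        ≡⟨ ℤ.pos-+ r s ⟩
      + r ℤ.+ + s
        ≡⟨ solve 5 (λ r s x y k → r :+ s := (r :+ x :* k) :+ (s :+ y :* k) :- (x :+ y) :* k)
                   refl (+ r) (+ s) x y (+ K) ⟩
      (+ r ℤ.+ x ℤ.* + K) ℤ.+ (+ s ℤ.+ y ℤ.* + K) ℤ.- (x ℤ.+ y) ℤ.* + K
        ≡⟨ cong₂ (λ u v → u ℤ.+ v ℤ.- (x ℤ.+ y) ℤ.* + K) (a≡a%ℕn+[a/ℕn]*n X K) (a≡a%ℕn+[a/ℕn]*n Y K) ⟨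
      X ℤ.+ Y ℤ.- (x ℤ.+ y) ℤ.* + K
        ≡⟨ cong (ℤ._- (x ℤ.+ y) ℤ.* + K) X+Y≡cK ⟩
      c ℤ.* + K ℤ.- (x ℤ.+ y) ℤ.* + K
        ≡⟨ solve 4 (λ c x y k → c :* k :- (x :+ y) :* k := (c :- x :- y) :* k) refl c x y (+ K) ⟩
      (c ℤ.- x ℤ.- y) ℤ.* + K
        ∎

  multiple-of-K : ∀ {r s t K} → r + s ≡ t * K → 0 < r → r < K → s < K → r + s ≡ K
  multiple-of-K {r} {t = zero}        r+s≡0  0<r _   _   = ⊥-elim (<⇒≢ 0<r (sym (m+n≡0⇒m≡0 r r+s≡0)))
  multiple-of-K {t = suc zero} {K}    r+s≡K  _   _   _   = trans r+s≡K (+-identityʳ K)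
  multiple-of-K {r} {s} {suc (suc t)} {K} r+s≡tK _ r<K s<K = ⊥-elim (<⇒≱ (+-mono-< r<K s<K) (begin
    K + K             ≤⟨ +-monoʳ-≤ K (m≤m+n K (t * K)) ⟩
    K + (K + t * K)   ≡⟨ r+s≡tK ⟨
    r + s             ∎))
    where open ≤-Reasoning

  residues-of-complement : ∀ (h : ℤ) K .{{_ : NonZero K}} μ → 0 < μ → μ < K → Coprime K ∣ h ∣ →
                           (h ℤ.* + μ) %ℕ K + (h ℤ.* + (K ∸ μ)) %ℕ K ≡ K
  residues-of-complement h K μ 0<μ μ<K coprime =
    let t , r+s≡tK = residues-sum-multiple hμ (h ℤ.* + (K ∸ μ)) h K hμ+h[K-μ]≡hK
    in  multiple-of-K {t = t} r+s≡tK (n≢0⇒n>0 r≢0) (n%ℕd<d hμ K) (n%ℕd<d (h ℤ.* + (K ∸ μ)) K)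
    where
    hμ = h ℤ.* + μ
    hμ+h[K-μ]≡hK : hμ ℤ.+ h ℤ.* + (K ∸ μ) ≡ h ℤ.* + K
    hμ+h[K-μ]≡hK = trans (sym (ℤ.*-distribˡ-+ h (+ μ) (+ (K ∸ μ))))
                         (cong (h ℤ.*_) (trans (sym (ℤ.pos-+ μ (K ∸ μ))) (cong +_ (m+[n∸m]≡n (<⇒≤ μ<K)))))
    r≢0 : hμ %ℕ K ≢ 0
    r≢0 r≡0 = <⇒≱ μ<K (∣⇒≤ {{>-nonZero 0<μ}} (coprime-divisor coprime (divides ∣ hμ /ℕ K ∣ (begin
      ∣ h ∣ * μ                              ≡⟨ ℤ.abs-* h (+ μ) ⟨
      ∣ hμ ∣                                 ≡⟨ cong ∣_∣ (a≡a%ℕn+[a/ℕn]*n hμ K) ⟩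
      ∣ + (hμ %ℕ K) ℤ.+ hμ /ℕ K ℤ.* + K ∣    ≡⟨ cong (λ r → ∣ + r ℤ.+ hμ /ℕ K ℤ.* + K ∣) r≡0 ⟩
      ∣ + 0 ℤ.+ hμ /ℕ K ℤ.* + K ∣            ≡⟨ cong ∣_∣ (ℤ.+-identityˡ (hμ /ℕ K ℤ.* + K)) ⟩
      ∣ hμ /ℕ K ℤ.* + K ∣                    ≡⟨ ℤ.abs-* (hμ /ℕ K) (+ K) ⟩
      ∣ hμ /ℕ K ∣ * K                        ∎))))
      where open ≡-Reasoning

module Reflection (K′ : ℕ) where

  K : ℕ
  K = suc K′

  #[_] : (ℕ → Bool) → ℕ
  #[ P ] = count (P ∘ suc) K′

  #-cong : ∀ {P Q} → (∀ μ → 0 < μ → μ < K → P μ ≡ Q μ) → #[ P ] ≡ #[ Q ]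
  #-cong P≗Q = ∑-cong K′ (λ j j<K′ → cong 𝟙 (P≗Q (suc j) z<s (s<s j<K′)))

  #-+ : ∀ P Q → #[ P ] + #[ Q ] ≡ ∑ (λ j → 𝟙 (P (suc j)) + 𝟙 (Q (suc j))) K′
  #-+ P Q = sym (∑-+ K′ (𝟙 ∘ P ∘ suc) (𝟙 ∘ Q ∘ suc))

  #-reflect : ∀ P → #[ P ] ≡ #[ (λ μ → P (K ∸ μ)) ]
  #-reflect P = trans (∑-reverse K′ (𝟙 ∘ P ∘ suc))
                      (∑-cong K′ (λ j j<K′ → cong (𝟙 ∘ P) (sym (+-∸-assoc 1 j<K′))))

  Symmetric : (ℕ → Bool) → Set
  Symmetric P = ∀ μ → 0 < μ → μ < K → P (K ∸ μ) ≡ P μ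

  Antisymmetric : (ℕ → Bool) → Set
  Antisymmetric P = ∀ μ → 0 < μ → μ < K → P (K ∸ μ) ≡ not (P μ)

  private
    double-injective : ∀ {m n} → m + m ≡ n + n → m ≡ n
    double-injective {m} {n} m+m≡n+n = *-cancelˡ-≡ m n 2
      (trans (cong (_+_ m) (+-identityʳ m)) (trans m+m≡n+n (sym (cong (_+_ n) (+-identityʳ n)))))

    sum-parity : ∀ {x y n} → x + y ≡ n → x % 2 ≡ (n + y) % 2
    sum-parity {x} {y} refl = sym (begin
      (x + y + y) % 2     ≡⟨ cong (_% 2) (solve 2 (λ x y → x :+ y :+ y := x :+ y :* con 2) refl x y) ⟩
      (x + y * 2) % 2     ≡⟨ [m+kn]%n≡m%n x y 2 ⟩
      x % 2               ∎)
      where open ≡-Reasoning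
            open +-*-Solver

  reflection-parity : ∀ {S E H : ℕ → Bool} n → Symmetric S → Antisymmetric E → Antisymmetric H →
    #[ S ] ≡ n + n →
    #[ (λ μ → not (E μ) ∧ S μ ∧ H μ) ] % 2 ≡ (n + #[ (λ μ → E μ ∧ S μ ∧ H μ) ]) % 2
  reflection-parity {S} {E} {H} n S-sym E-anti H-anti #S≡2n = sum-parity (begin
    #[ odd∧H ] + #[ even∧H ]      ≡⟨ cong (_+ #[ even∧H ]) odd∧H≡even∧¬H ⟩
    #[ even∧¬H ] + #[ even∧H ]    ≡⟨ +-comm #[ even∧¬H ] #[ even∧H ] ⟩
    #[ even∧H ] + #[ even∧¬H ]    ≡⟨ trans (#-+ even∧H even∧¬H) (∑-cong K′ (λ j _ → split-H (suc j))) ⟩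
    #[ even ]                     ≡⟨ double-injective (begin
      #[ even ] + #[ even ]         ≡⟨ cong (_+_ #[ even ]) odd≡even ⟨
      #[ even ] + #[ odd ]          ≡⟨ trans (#-+ even odd) (∑-cong K′ (λ j _ → split-E (suc j))) ⟩
      #[ S ]                        ≡⟨ #S≡2n ⟩
      n + n                         ∎) ⟩
    n                             ∎)
    where
    open ≡-Reasoning
    even odd even∧H even∧¬H odd∧H : ℕ → Bool
    even    μ = E μ ∧ S μ
    odd     μ = not (E μ) ∧ S μ
    even∧H  μ = E μ ∧ S μ ∧ H μ
    even∧¬H μ = E μ ∧ S μ ∧ not (H μ)
    odd∧H   μ = not (E μ) ∧ S μ ∧ H μ

    odd∧H≡even∧¬H : #[ odd∧H ] ≡ #[ even∧¬H ]
    odd∧H≡even∧¬H = trans (#-reflect odd∧H) (#-cong reflected)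
      where
      reflected : ∀ μ → 0 < μ → μ < K → odd∧H (K ∸ μ) ≡ even∧¬H μ
      reflected μ 0<μ μ<K
        rewrite E-anti μ 0<μ μ<K | S-sym μ 0<μ μ<K | H-anti μ 0<μ μ<K | not-involutive (E μ) = refl

    odd≡even : #[ odd ] ≡ #[ even ]
    odd≡even = trans (#-reflect odd) (#-cong reflected)
      where
      reflected : ∀ μ → 0 < μ → μ < K → odd (K ∸ μ) ≡ even μ
      reflected μ 0<μ μ<K rewrite E-anti μ 0<μ μ<K | S-sym μ 0<μ μ<K | not-involutive (E μ) = refl

    split-H : ∀ μ → 𝟙 (even∧H μ) + 𝟙 (even∧¬H μ) ≡ 𝟙 (even μ)
    split-H μ with E μ | S μ | H μ
    ... | true  | true  | true  = refl
    ... | true  | true  | false = refl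
    ... | true  | false | _     = refl
    ... | false | _     | _     = refl

    split-E : ∀ μ → 𝟙 (even μ) + 𝟙 (odd μ) ≡ 𝟙 (S μ)
    split-E μ with E μ | S μ
    ... | true  | true  = refl
    ... | true  | false = refl
    ... | false | true  = refl
    ... | false | false = refl

quarter-form : ∀ {p} → p % 4 ≡ 1 → ∃ λ q → p ≡ suc ((q + q) + (q + q))
quarter-form {p} p%4≡1 = p / 4 , (begin
  p                                          ≡⟨ m≡m%n+[m/n]*n p 4 ⟩
  p % 4 + p / 4 * 4                          ≡⟨ cong (_+ p / 4 * 4) p%4≡1 ⟩
  1 + p / 4 * 4                              ≡⟨ solve 1 (λ q → con 1 :+ q :* con 4 := con 1 :+ ((q :+ q) :+ (q :+ q)))
                                                        refl (p / 4) ⟩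
  suc ((p / 4 + p / 4) + (p / 4 + p / 4))    ∎)
  where open ≡-Reasoning
        open +-*-Solver

quarter-/4 : ∀ q → ((q + q) + (q + q)) / 4 ≡ q
quarter-/4 q = trans (cong (_/ 4) (solve 1 (λ q → (q :+ q) :+ (q :+ q) := q :* con 4) refl q)) (m*n/n≡m q 4)
  where open +-*-Solver

double%2 : ∀ q → (q + q) % 2 ≡ 0
double%2 q = trans (cong (_% 2) (trans (cong (q +_) (sym (+-identityʳ q))) (*-comm 2 q))) (m*n%n≡0 q 2)

odd-factor : ∀ k p → (k * p) % 2 ≡ 1 → k % 2 ≡ 1
odd-factor k p kp-odd with k % 2 in k%2 | m%n<n k 2
... | 1           | _ = refl
... | suc (suc _) | s<s (s<s ())
... | 0           | _ = ⊥-elim (0≢1+n (begin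
  0                          ≡⟨⟩
  (0 * (p % 2)) % 2          ≡⟨ cong (λ r → (r * (p % 2)) % 2) k%2 ⟨
  ((k % 2) * (p % 2)) % 2    ≡⟨ %-distribˡ-* k p 2 ⟨
  (k * p) % 2                ≡⟨ kp-odd ⟩
  1                          ∎))
  where open ≡-Reasoning

odd-*-parity : ∀ {k} q y → k % 2 ≡ 1 → (k * q + y) % 2 ≡ (q + y) % 2
odd-*-parity {k} q y k-odd = begin
  (k * q + y) % 2                   ≡⟨ cong (λ k → (k * q + y) % 2) k≡1+2t ⟩
  ((1 + k / 2 * 2) * q + y) % 2     ≡⟨ cong (_% 2) (solve 3 (λ t q y → (con 1 :+ t :* con 2) :* q :+ y
                                                                   := (q :+ y) :+ (t :* q) :* con 2)
                                                              refl (k / 2) q y) ⟩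
  ((q + y) + (k / 2 * q) * 2) % 2   ≡⟨ [m+kn]%n≡m%n (q + y) (k / 2 * q) 2 ⟩
  (q + y) % 2                       ∎
  where
  open ≡-Reasoning
  open +-*-Solver
  k≡1+2t : k ≡ 1 + k / 2 * 2
  k≡1+2t = trans (m≡m%n+[m/n]*n k 2) (cong (_+ k / 2 * 2) k-odd)

isEven-+ : ∀ a b → (a + b) % 2 ≡ 1 → isEven a ≡ not (isEven b)
isEven-+ a b a+b-odd =
  parities (a % 2) (b % 2) (m%n<n a 2) (m%n<n b 2) (trans (sym (%-distribˡ-+ a b 2)) a+b-odd)
  where
  parities : ∀ x y → x < 2 → y < 2 → (x + y) % 2 ≡ 1 → (x ≡ᵇ 0) ≡ not (y ≡ᵇ 0)
  parities 0 1 _ _ _ = refl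
  parities 1 0 _ _ _ = refl
  parities 0 0 _ _ ()
  parities 1 1 _ _ ()
  parities (suc (suc _)) _ (s<s (s<s ())) _ _
  parities _ (suc (suc _)) _ (s<s (s<s ())) _

∧-duplicate : ∀ a e c h → a ∧ e ∧ (a ∧ c) ∧ h ≡ e ∧ (a ∧ c) ∧ h
∧-duplicate true  e     c h = refl
∧-duplicate false false c h = refl
∧-duplicate false true  c h = refl

module _ (q k K′ : ℕ) (h : ℤ) (prime : Prime (suc ((q + q) + (q + q))))
         (K≡kp : suc K′ ≡ k * suc ((q + q) + (q + q))) (K-odd : suc K′ % 2 ≡ 1)
         (coprime : Coprime (suc K′) ∣ h ∣) where

  private
    m = q + q
    open Modulo (m + m)
    open Residues (m + m)
    open OddPrime m prime
    open Reflection K′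

    H : ℕ → Bool
    H μ = isOdd (modZ (h ℤ.* ℤ.+ μ) K)

    H-anti : Antisymmetric H
    H-anti μ 0<μ μ<K = cong not (isEven-+ r′ r (trans (cong (_% 2) r′+r≡K) K-odd))
      where
      r  = (h ℤ.* ℤ.+ μ) %ℕ K
      r′ = (h ℤ.* ℤ.+ (K ∸ μ)) %ℕ K
      r′+r≡K = trans (+-comm r′ r) (residues-of-complement h K μ 0<μ μ<K coprime)

    isEven-anti : Antisymmetric isEven
    isEven-anti μ _ μ<K = isEven-+ (K ∸ μ) μ (trans (cong (_% 2) (m∸n+n≡m (<⇒≤ μ<K))) K-odd)

    complement≈0 : ∀ {μ} → μ < K → K ∸ μ + μ ≈ 0
    complement≈0 μ<K = ≈-trans (≈-reflexive (trans (m∸n+n≡m (<⇒≤ μ<K)) K≡kp)) (*p≈0 k)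

    k-odd : k % 2 ≡ 1
    k-odd = odd-factor k p (subst (λ K → K % 2 ≡ 1) K≡kp K-odd)

    #-by-period : ∀ (χ : ℕ → Bool) → χ 0 ≡ false → (∀ {a b} → a ≈ b → χ a ≡ χ b) →
                  count χ p ≡ m → #[ χ ] ≡ k * q + k * q
    #-by-period χ χ0≡false χ-cong count≡m = begin
      #[ χ ]             ≡⟨ cong (λ b → 𝟙 b + #[ χ ]) χ0≡false ⟨
      count χ K          ≡⟨ cong (count χ) K≡kp ⟩
      count χ (k * p)    ≡⟨ ∑-periodic k p (𝟙 ∘ χ) (λ a → cong 𝟙 (χ-cong (p+≈ a))) ⟩
      k * count χ p      ≡⟨ cong (k *_) count≡m ⟩
      k * (q + q)        ≡⟨ *-distribˡ-+ k q q ⟩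
      k * q + k * q      ∎
      where open ≡-Reasoning

    module _ (c : ℕ → ℕ → Bool) where
      private
        χ′ : ℕ → ℕ → Bool
        χ′ p μ = not (divBy p μ) ∧ c p μ
        χ = χ′ p

      countτ-as-# : ∀ par → countτ par χ′ p h K ≡ #[ (λ μ → par μ ∧ χ μ ∧ H μ) ]
      countτ-as-# par = trans (length-filter-applyUpTo _ suc K′) (∑-cong K′ λ j _ →
        cong 𝟙 (∧-duplicate (not (divBy p (suc j))) (par (suc j)) (c p (suc j)) (H (suc j))))

      countτ-parity : Symmetric χ → (∀ {a b} → a ≈ b → χ a ≡ χ b) → count χ p ≡ m →
                      countτ isOdd χ′ p h K % 2 ≡ (q + countτ isEven χ′ p h K) % 2
      countτ-parity χ-sym χ-cong count≡m = begin
        countτ isOdd χ′ p h K % 2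
          ≡⟨ cong (_% 2) (countτ-as-# isOdd) ⟩
        #[ (λ μ → isOdd μ ∧ χ μ ∧ H μ) ] % 2
          ≡⟨ reflection-parity (k * q) χ-sym isEven-anti H-anti (#-by-period χ refl χ-cong count≡m) ⟩
        (k * q + #[ (λ μ → isEven μ ∧ χ μ ∧ H μ) ]) % 2
          ≡⟨ odd-*-parity {k} q _ k-odd ⟩
        (q + #[ (λ μ → isEven μ ∧ χ μ ∧ H μ) ]) % 2
          ≡⟨ cong (λ t → (q + t) % 2) (countτ-as-# isEven) ⟨
        (q + countτ isEven χ′ p h K) % 2
          ∎
        where open ≡-Reasoning

    i²≈-1 : MinusOneSquare
    i²≈-1 = minus-one-square (double%2 q)

  τ-parities : (τos p h K % 2 ≡ (q + τes p h K) % 2) × (τor p h K % 2 ≡ (q + τer p h K) % 2)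
  τ-parities =
    countτ-parity (λ p μ → not (isQR p μ))
      (λ μ _ μ<K → legendreIsM1-neg i²≈-1 {K ∸ μ} {μ} (complement≈0 μ<K))
      legendreIsM1-cong count-legendreIsM1 ,
    countτ-parity isQR
      (λ μ _ μ<K → legendreIs1-neg i²≈-1 {K ∸ μ} {μ} (complement≈0 μ<K))
      legendreIs1-cong count-legendreIs1

lemma16p4 : (p k K : ℕ) (h : ℤ) → Prime p → p % 4 ≡ 1 → k ≥ 1 → K ≡ k * p → K % 2 ≡ 1
            → gcd h (ℤ.+ K) ≡ ℤ.+ 1
            → (τos p h K % 2 ≡ ((p ∸ 1) / 4 + τes p h K) % 2)
              × (τor p h K % 2 ≡ ((p ∸ 1) / 4 + τer p h K) % 2)
lemma16p4 p k zero     h p-prime p%4≡1 _ K≡kp ()    gcd≡1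
lemma16p4 p k (suc K′) h p-prime p%4≡1 _ K≡kp K-odd gcd≡1
  with q , refl ← quarter-form {p} p%4≡1 rewrite quarter-/4 q =
  τ-parities q k K′ h p-prime K≡kp K-odd (Coprimality.sym (gcd≡1⇒coprime (ℤ.+-injective gcd≡1)))
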